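{- Let $n\geq 3$ and let $(d_1,\dots,d_n)$ be a sequence of non-negative integers satisfying - $d_2\geq d_3\geq\cdots\geq d_n\geq 4$, - $d_1+\cdots+d_n$ is even, - $d_1\leq \sum_{i=2}^n (d_i-1)$, - $D:=\sum_{i=1}^n (-1)^{i-1} d_i \geq n-2$. Then there exists a triangular multigraph $G$ on vertices $v_1,\dots,v_n$ with $\deg(v_i)=d_i$ for all $i$.
   Context: Note that $d_1$ is not assumed to be the largest term. A multigraph is a finite graph in which multiple edges between the same pair of vertices are allowed; the degree of a vertex is the number of incident edges counted with multiplicity. A triangle in a multigraph consists of three distinct vertices which are pairwise adjacent. A multigraph is triangular if every edge is contained in a triangle. -}

module Defs where

open import Data.Nat using (ℕ; zero; suc; _+_; _∸_; _<_; _≤_)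
open import Data.Integer as ℤ using (ℤ; +_)
open import Data.Fin using (Fin; toℕ)
open import Data.Product using (Σ; ∃; _×_)
open import Relation.Binary.PropositionalEquality using (_≡_; _≢_)
open import Data.Vec.Functional using (Vector)

Σℕ : (n : ℕ) → (Fin n → ℕ) → ℕ
Σℕ zero f = 0
Σℕ (suc n) f = f Data.Fin.zero + Σℕ n (λ i → f (Data.Fin.suc i))


Σℤ : (n : ℕ) → (Fin n → ℤ) → ℤ
Σℤ zero f = + 0
Σℤ (suc n) f = f Data.Fin.zero ℤ.+ Σℤ n (λ i → f (Data.Fin.suc i))


altSign : ℕ → ℤ → ℤ
altSign zero x = x
altSign (suc k) x = ℤ.- altSign k x

record Multigraph (n : ℕ) : Set where
  field
    mult     : Fin n → Fin n → ℕ
    symmetric : ∀ i j → mult i j ≡ mult j i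
    loopless : ∀ i → mult i i ≡ 0

open Multigraph public

adjacent : ∀ {n} → Multigraph n → Fin n → Fin n → Set
adjacent G i j = 0 < mult G i j

degree : ∀ {n} → Multigraph n → Fin n → ℕ
degree {n} G i = Σℕ n (λ j → mult G i j)

Triangular : ∀ {n} → Multigraph n → Set
Triangular {n} G = ∀ i j → adjacent G i j →
  ∃ λ (k : Fin n) → k ≢ i × k ≢ j × adjacent G i k × adjacent G j k

-- Σ over indices i ≥ 2 (1-based), i.e. all positions except the first one (0-based index 0)
ΣfromSecond : (n : ℕ) → (Fin n → ℕ) → ℕ
ΣfromSecond zero f = 0
ΣfromSecond (suc n) f = Σℕ n (λ i → f (Data.Fin.suc i))

{-# OPTIONS --safe #-}
module Submission where

open import Defs
open import Data.Nat using (ℕ; zero; suc; _+_; _*_; _∸_; _≤_; _≥_; _<_; z≤n; s≤s; _≤?_; ⌊_/2⌋; ⌈_/2⌉)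
open import Data.Nat.Properties
open import Data.Nat.Divisibility using (_∣_; divides; ∣m+n∣m⇒∣n)
open import Data.Nat.Tactic.RingSolver using (solve-∀)
open import Data.Integer as ℤ using (ℤ; +_)
import Data.Integer.Properties as ℤ
import Data.Integer.Tactic.RingSolver as ℤ-Solver
open import Data.Fin using (Fin; toℕ; zero; suc)
open import Data.Fin.Properties using () renaming (suc-injective to Fin-suc-injective)
open import Data.Vec.Functional using (tail)
open import Data.Product using (Σ; ∃; _×_; _,_; proj₁; proj₂)
open import Data.Empty using (⊥-elim)
open import Relation.Binary.PropositionalEquality
open import Relation.Nullary using (yes; no)

-- Vertex v₁ is the hub. The other vertices are grouped into consecutive pairs (a, b), plus one
-- final triple (a, b, c) when n − 1 is odd. A pair is joined by y parallel edges and both of its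
-- vertices are joined to the hub, so every edge lies in a triangle through the hub; in the triple
-- c is moreover joined once to b and to the hub. If S is the number of edges avoiding the hub,
-- the hub has degree d₂ + ⋯ + d_n − 2S, so S is determined by d₁, and it remains to write S as
-- a sum of one value y ∈ [1, b − 1] per pair (y + 1 ∈ [2, b − 1] for the triple, counting the
-- edge bc). This is possible exactly when ⌈(n − 1)/2⌉ ≤ S ≤ Σ_pairs (b − 1). The lower bound is
-- d₁ ≤ Σ (dᵢ − 1). The upper bound is D ≥ n − 2, since D = d₁ − (d₂ + d₄ + ⋯) + (d₃ + d₅ + ⋯)
-- and d₃ + d₅ + ⋯ = Σ_pairs b.

Σℕ-zero : ∀ m → Σℕ m (λ _ → 0) ≡ 0
Σℕ-zero zero    = refl
Σℕ-zero (suc m) = Σℕ-zero m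

Σℕ-∸1 : ∀ m (e : Fin m → ℕ) → (∀ i → 1 ≤ e i) → Σℕ m (λ i → e i ∸ 1) + m ≡ Σℕ m e
Σℕ-∸1 zero    e e≥1 = refl
Σℕ-∸1 (suc m) e e≥1 = trans (regroup (e zero ∸ 1) _ m)
  (cong₂ _+_ (m∸n+n≡m (e≥1 zero)) (Σℕ-∸1 m (tail e) (λ i → e≥1 (suc i))))
  where
  regroup : ∀ p x k → p + x + suc k ≡ (p + 1) + (x + k)
  regroup = solve-∀

evens odds : (m : ℕ) → (Fin m → ℕ) → ℕ
evens zero    e = 0
evens (suc m) e = e zero + odds m (tail e)
odds zero    e = 0
odds (suc m) e = evens m (tail e)

Σℕ≡evens+odds : ∀ m (e : Fin m → ℕ) → Σℕ m e ≡ evens m e + odds m e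
Σℕ≡evens+odds zero    e = refl
Σℕ≡evens+odds (suc m) e =
  trans (cong (λ t → e zero + t) (Σℕ≡evens+odds m (tail e))) (regroup (e zero) _ _)
  where
  regroup : ∀ a x y → a + (x + y) ≡ a + y + x
  regroup = solve-∀

Σℤ-neg : ∀ m (f : Fin m → ℤ) → Σℤ m (λ i → ℤ.- f i) ≡ ℤ.- Σℤ m f
Σℤ-neg zero    f = refl
Σℤ-neg (suc m) f =
  trans (cong (λ t → ℤ.- f zero ℤ.+ t) (Σℤ-neg m (tail f))) (sym (ℤ.neg-distrib-+ (f zero) _))

alternatingΣ : (m : ℕ) → (Fin m → ℕ) → ℤ
alternatingΣ m e = Σℤ m (λ i → altSign (toℕ i) (+ e i))

alternatingΣ+odds≡evens : ∀ m (e : Fin m → ℕ) → alternatingΣ m e ℤ.+ + odds m e ≡ + evens m e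
alternatingΣ+odds≡evens zero    e = refl
alternatingΣ+odds≡evens (suc m) e = begin
  + e zero ℤ.+ Σℤ m (λ i → ℤ.- altSign (toℕ i) (+ e (suc i))) ℤ.+ + evens m (tail e)
    ≡⟨ cong₂ (λ s t → + e zero ℤ.+ s ℤ.+ t)
         (Σℤ-neg m _) (sym (alternatingΣ+odds≡evens m (tail e))) ⟩
  + e zero ℤ.+ ℤ.- A ℤ.+ (A ℤ.+ + odds m (tail e))
    ≡⟨ cancel (+ e zero) A _ ⟩
  + e zero ℤ.+ + odds m (tail e)
    ≡⟨ ℤ.pos-+ (e zero) _ ⟨
  + (e zero + odds m (tail e)) ∎
  where
  open ≡-Reasoning
  A = alternatingΣ m (tail e)
  cancel : ∀ x a o → x ℤ.+ ℤ.- a ℤ.+ (a ℤ.+ o) ≡ x ℤ.+ o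
  cancel = ℤ-Solver.solve-∀

alternatingΣ-bound : ∀ k m (e : Fin m → ℕ) → + k ℤ.≤ alternatingΣ m e → k + odds m e ≤ evens m e
alternatingΣ-bound k m e k≤Σ = ℤ.drop‿+≤+ (subst₂ ℤ._≤_
  (sym (ℤ.pos-+ k (odds m e))) (alternatingΣ+odds≡evens m e) (ℤ.+-monoˡ-≤ (+ odds m e) k≤Σ))

m≤n+n⇒⌈m/2⌉≤n : ∀ {m n} → m ≤ n + n → ⌈ m /2⌉ ≤ n
m≤n+n⇒⌈m/2⌉≤n {n = n} m≤n+n = subst (_ ≤_) (sym (n≡⌈n+n/2⌉ n)) (⌈n/2⌉-mono m≤n+n)

m+m≤1+n+n⇒m≤n : ∀ {m n} → m + m ≤ suc (n + n) → m ≤ n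
m+m≤1+n+n⇒m≤n {m} {n} le = subst₂ _≤_ (sym (n≡⌊n+n/2⌋ m)) (sym (n≡⌈n+n/2⌉ n)) (⌊n/2⌋-mono le)

⌊m/2⌋+⌊m/2⌋≤m : ∀ m → ⌊ m /2⌋ + ⌊ m /2⌋ ≤ m
⌊m/2⌋+⌊m/2⌋≤m m = ≤-trans (+-monoʳ-≤ ⌊ m /2⌋ (⌊n/2⌋≤⌈n/2⌉ m)) (≤-reflexive (⌊n/2⌋+⌈n/2⌉≡n m))

even-gap : ∀ {a b} → 2 ∣ a + b → a ≤ b → ∃ λ S → a + (S + S) ≡ b
even-gap {a} {b} 2∣a+b a≤b = S , trans (cong (λ t → a + t) S+S≡b∸a) (m+[n∸m]≡n a≤b)
  where
  double : ∀ x → x + x ≡ x * 2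
  double = solve-∀
  a+b≡a+a+[b∸a] : a + b ≡ a + a + (b ∸ a)
  a+b≡a+a+[b∸a] = trans (cong (λ t → a + t) (sym (m+[n∸m]≡n a≤b))) (sym (+-assoc a a _))
  2∣b∸a : 2 ∣ b ∸ a
  2∣b∸a = ∣m+n∣m⇒∣n (subst (2 ∣_) a+b≡a+a+[b∸a] 2∣a+b) (divides a (double a))
  S : ℕ
  S = _∣_.quotient 2∣b∸a
  S+S≡b∸a : S + S ≡ b ∸ a
  S+S≡b∸a = trans (double S) (sym (_∣_.equality 2∣b∸a))

singleton : Multigraph 1
singleton = record { mult = λ _ _ → 0 ; symmetric = λ _ _ → refl ; loopless = λ _ → refl }

singleton-triangular : Triangular singleton
singleton-triangular i j ()

-- Vertex 0 stays the hub, the new vertices a and b are 1 and 2, and the other vertices of M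
-- move up by two.
module AttachPair {m : ℕ} (M : Multigraph (suc m)) (xa xb y : ℕ) where

  edges : Fin (3 + m) → Fin (3 + m) → ℕ
  edges zero                zero                = 0
  edges zero                (suc zero)          = xa
  edges zero                (suc (suc zero))    = xb
  edges zero                (suc (suc (suc j))) = mult M zero (suc j)
  edges (suc zero)          zero                = xa
  edges (suc zero)          (suc zero)          = 0
  edges (suc zero)          (suc (suc zero))    = y
  edges (suc zero)          (suc (suc (suc j))) = 0
  edges (suc (suc zero))    zero                = xb
  edges (suc (suc zero))    (suc zero)          = y
  edges (suc (suc zero))    (suc (suc zero))    = 0
  edges (suc (suc zero))    (suc (suc (suc j))) = 0
  edges (suc (suc (suc i))) zero                = mult M (suc i) zero
  edges (suc (suc (suc i))) (suc zero)          = 0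
  edges (suc (suc (suc i))) (suc (suc zero))    = 0
  edges (suc (suc (suc i))) (suc (suc (suc j))) = mult M (suc i) (suc j)

  edges-symmetric : ∀ i j → edges i j ≡ edges j i
  edges-symmetric zero                zero                = refl
  edges-symmetric zero                (suc zero)          = refl
  edges-symmetric zero                (suc (suc zero))    = refl
  edges-symmetric zero                (suc (suc (suc j))) = symmetric M zero (suc j)
  edges-symmetric (suc zero)          zero                = refl
  edges-symmetric (suc zero)          (suc zero)          = refl
  edges-symmetric (suc zero)          (suc (suc zero))    = refl
  edges-symmetric (suc zero)          (suc (suc (suc j))) = refl
  edges-symmetric (suc (suc zero))    zero                = refl
  edges-symmetric (suc (suc zero))    (suc zero)          = refl
  edges-symmetric (suc (suc zero))    (suc (suc zero))    = refl
  edges-symmetric (suc (suc zero))    (suc (suc (suc j))) = refl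
  edges-symmetric (suc (suc (suc i))) zero                = symmetric M (suc i) zero
  edges-symmetric (suc (suc (suc i))) (suc zero)          = refl
  edges-symmetric (suc (suc (suc i))) (suc (suc zero))    = refl
  edges-symmetric (suc (suc (suc i))) (suc (suc (suc j))) = symmetric M (suc i) (suc j)

  edges-loopless : ∀ i → edges i i ≡ 0
  edges-loopless zero                = refl
  edges-loopless (suc zero)          = refl
  edges-loopless (suc (suc zero))    = refl
  edges-loopless (suc (suc (suc i))) = loopless M (suc i)

  graph : Multigraph (3 + m)
  graph = record { mult = edges ; symmetric = edges-symmetric ; loopless = edges-loopless }

  old : Fin (suc m) → Fin (3 + m)
  old zero    = zero
  old (suc j) = suc (suc (suc j))

  old-injective : ∀ i j → old i ≡ old j → i ≡ j
  old-injective zero    zero    _  = refl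
  old-injective (suc i) (suc j) eq =
    cong suc (Fin-suc-injective (Fin-suc-injective (Fin-suc-injective eq)))

  old-adjacent : ∀ i j → adjacent M i j → adjacent graph (old i) (old j)
  old-adjacent zero    zero    i~j = ⊥-elim (<-irrefl refl (subst (0 <_) (loopless M zero) i~j))
  old-adjacent zero    (suc j) i~j = i~j
  old-adjacent (suc i) zero    i~j = i~j
  old-adjacent (suc i) (suc j) i~j = i~j

  old-triangle : Triangular M → ∀ i j → adjacent M i j →
    ∃ λ k → k ≢ old i × k ≢ old j × adjacent graph (old i) k × adjacent graph (old j) k
  old-triangle M-tri i j i~j with M-tri i j i~j
  ... | k , k≢i , k≢j , i~k , j~k =
    old k , (λ eq → k≢i (old-injective k i eq)) , (λ eq → k≢j (old-injective k j eq)) ,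
    old-adjacent i k i~k , old-adjacent j k j~k

  triangular : Triangular M → 1 ≤ xa → 1 ≤ xb → 1 ≤ y → Triangular graph
  triangular M-tri xa≥1 xb≥1 y≥1 = tri
    where
    tri : Triangular graph
    tri zero                zero                ()
    tri zero                (suc zero)          _ = suc (suc zero) , (λ ()) , (λ ()) , xb≥1 , y≥1
    tri zero                (suc (suc zero))    _ = suc zero , (λ ()) , (λ ()) , xa≥1 , y≥1
    tri zero                (suc (suc (suc j))) h = old-triangle M-tri zero (suc j) h
    tri (suc zero)          zero                _ = suc (suc zero) , (λ ()) , (λ ()) , y≥1 , xb≥1
    tri (suc zero)          (suc zero)          ()
    tri (suc zero)          (suc (suc zero))    _ = zero , (λ ()) , (λ ()) , xa≥1 , xb≥1
    tri (suc zero)          (suc (suc (suc j))) ()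
    tri (suc (suc zero))    zero                _ = suc zero , (λ ()) , (λ ()) , y≥1 , xa≥1
    tri (suc (suc zero))    (suc zero)          _ = zero , (λ ()) , (λ ()) , xb≥1 , xa≥1
    tri (suc (suc zero))    (suc (suc zero))    ()
    tri (suc (suc zero))    (suc (suc (suc j))) ()
    tri (suc (suc (suc i))) zero                h = old-triangle M-tri (suc i) zero h
    tri (suc (suc (suc i))) (suc zero)          ()
    tri (suc (suc (suc i))) (suc (suc zero))    ()
    tri (suc (suc (suc i))) (suc (suc (suc j))) h = old-triangle M-tri (suc i) (suc j) h

  degree-hub : degree graph zero ≡ xa + xb + degree M zero
  degree-hub rewrite loopless M zero = sym (+-assoc xa xb _)

  y+Σ0≡y : y + Σℕ m (λ _ → 0) ≡ y
  y+Σ0≡y = trans (cong (λ t → y + t) (Σℕ-zero m)) (+-identityʳ y)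

  degree-a : degree graph (suc zero) ≡ xa + y
  degree-a = cong (λ t → xa + t) y+Σ0≡y

  degree-b : degree graph (suc (suc zero)) ≡ xb + y
  degree-b = cong (λ t → xb + t) y+Σ0≡y

-- The triangles hub–a–b and hub–b–c on the vertices 0 (hub), 1 (a), 2 (b) and 3 (c).
module TwoTriangles (xa xb xc y z : ℕ) where

  edges : Fin 4 → Fin 4 → ℕ
  edges zero                   zero                   = 0
  edges zero                   (suc zero)             = xa
  edges zero                   (suc (suc zero))       = xb
  edges zero                   (suc (suc (suc zero))) = xc
  edges (suc zero)             zero                   = xa
  edges (suc zero)             (suc zero)             = 0
  edges (suc zero)             (suc (suc zero))       = y
  edges (suc zero)             (suc (suc (suc zero))) = 0
  edges (suc (suc zero))       zero                   = xb
  edges (suc (suc zero))       (suc zero)             = y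
  edges (suc (suc zero))       (suc (suc zero))       = 0
  edges (suc (suc zero))       (suc (suc (suc zero))) = z
  edges (suc (suc (suc zero))) zero                   = xc
  edges (suc (suc (suc zero))) (suc zero)             = 0
  edges (suc (suc (suc zero))) (suc (suc zero))       = z
  edges (suc (suc (suc zero))) (suc (suc (suc zero))) = 0

  edges-symmetric : ∀ i j → edges i j ≡ edges j i
  edges-symmetric zero                   zero                   = refl
  edges-symmetric zero                   (suc zero)             = refl
  edges-symmetric zero                   (suc (suc zero))       = refl
  edges-symmetric zero                   (suc (suc (suc zero))) = refl
  edges-symmetric (suc zero)             zero                   = refl
  edges-symmetric (suc zero)             (suc zero)             = refl
  edges-symmetric (suc zero)             (suc (suc zero))       = refl
  edges-symmetric (suc zero)             (suc (suc (suc zero))) = refl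
  edges-symmetric (suc (suc zero))       zero                   = refl
  edges-symmetric (suc (suc zero))       (suc zero)             = refl
  edges-symmetric (suc (suc zero))       (suc (suc zero))       = refl
  edges-symmetric (suc (suc zero))       (suc (suc (suc zero))) = refl
  edges-symmetric (suc (suc (suc zero))) zero                   = refl
  edges-symmetric (suc (suc (suc zero))) (suc zero)             = refl
  edges-symmetric (suc (suc (suc zero))) (suc (suc zero))       = refl
  edges-symmetric (suc (suc (suc zero))) (suc (suc (suc zero))) = refl

  edges-loopless : ∀ i → edges i i ≡ 0
  edges-loopless zero                   = refl
  edges-loopless (suc zero)             = refl
  edges-loopless (suc (suc zero))       = refl
  edges-loopless (suc (suc (suc zero))) = refl

  graph : Multigraph 4
  graph = record { mult = edges ; symmetric = edges-symmetric ; loopless = edges-loopless }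

  triangular : 1 ≤ xa → 1 ≤ xb → 1 ≤ xc → 1 ≤ y → 1 ≤ z → Triangular graph
  triangular xa≥1 xb≥1 xc≥1 y≥1 z≥1 = tri
    where
    tri : Triangular graph
    tri zero                   zero                   ()
    tri zero                   (suc zero)             _ = suc (suc zero) , (λ ()) , (λ ()) , xb≥1 , y≥1
    tri zero                   (suc (suc zero))       _ = suc zero , (λ ()) , (λ ()) , xa≥1 , y≥1
    tri zero                   (suc (suc (suc zero))) _ = suc (suc zero) , (λ ()) , (λ ()) , xb≥1 , z≥1
    tri (suc zero)             zero                   _ = suc (suc zero) , (λ ()) , (λ ()) , y≥1 , xb≥1
    tri (suc zero)             (suc zero)             ()
    tri (suc zero)             (suc (suc zero))       _ = zero , (λ ()) , (λ ()) , xa≥1 , xb≥1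
    tri (suc zero)             (suc (suc (suc zero))) ()
    tri (suc (suc zero))       zero                   _ = suc zero , (λ ()) , (λ ()) , y≥1 , xa≥1
    tri (suc (suc zero))       (suc zero)             _ = zero , (λ ()) , (λ ()) , xb≥1 , xa≥1
    tri (suc (suc zero))       (suc (suc zero))       ()
    tri (suc (suc zero))       (suc (suc (suc zero))) _ = zero , (λ ()) , (λ ()) , xb≥1 , xc≥1
    tri (suc (suc (suc zero))) zero                   _ = suc (suc zero) , (λ ()) , (λ ()) , z≥1 , xb≥1
    tri (suc (suc (suc zero))) (suc zero)             ()
    tri (suc (suc (suc zero))) (suc (suc zero))       _ = zero , (λ ()) , (λ ()) , xc≥1 , xb≥1
    tri (suc (suc (suc zero))) (suc (suc (suc zero))) ()

m≤n∸1⇒m<n : ∀ {m n} → 1 ≤ n → m ≤ n ∸ 1 → m < n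
m≤n∸1⇒m<n (s≤s z≤n) m≤n∸1 = s≤s m≤n∸1

split-between : ∀ {k u c S} → 1 ≤ c → k ≤ u → k < S → S ≤ c + u →
  ∃ λ y → 1 ≤ y × y ≤ c × ∃ λ S′ → S ≡ y + S′ × k ≤ S′ × S′ ≤ u
split-between {k} {u} {c} {suc S} c≥1 k≤u (s≤s k≤S) 1+S≤c+u with S ≤? u
... | yes S≤u = 1 , ≤-refl , c≥1 , S , refl , k≤S , S≤u
... | no  S≰u = suc (S ∸ u) , s≤s z≤n , y≤c , u , sym 1+[S∸u]+u≡1+S , k≤u , ≤-refl
  where
  1+[S∸u]+u≡1+S : suc (S ∸ u) + u ≡ suc S
  1+[S∸u]+u≡1+S = cong suc (m∸n+n≡m (<⇒≤ (≰⇒> S≰u)))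
  y≤c : suc (S ∸ u) ≤ c
  y≤c = +-cancelʳ-≤ u _ _ (subst (_≤ c + u) (sym 1+[S∸u]+u≡1+S) 1+S≤c+u)

capacity : (m : ℕ) → (Fin m → ℕ) → ℕ
capacity zero          e = 0
capacity (suc zero)    e = 0
capacity (suc (suc m)) e = (e (suc zero) ∸ 1) + capacity m (tail (tail e))

odds≡capacity+⌊m/2⌋ : ∀ m (e : Fin m → ℕ) → (∀ i → 1 ≤ e i) → odds m e ≡ capacity m e + ⌊ m /2⌋
odds≡capacity+⌊m/2⌋ zero          e e≥1 = refl
odds≡capacity+⌊m/2⌋ (suc zero)    e e≥1 = refl
odds≡capacity+⌊m/2⌋ (suc (suc m)) e e≥1 = trans
  (cong₂ _+_ (sym (m∸n+n≡m (e≥1 (suc zero))))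
             (odds≡capacity+⌊m/2⌋ m (tail (tail e)) (λ i → e≥1 (suc (suc i)))))
  (regroup (e (suc zero) ∸ 1) _ _)
  where
  regroup : ∀ p c k → p + 1 + (c + k) ≡ p + c + suc k
  regroup = solve-∀

⌈m/2⌉≤capacity : ∀ m (e : Fin (2 + m) → ℕ) → (∀ i → 3 ≤ e i) → ⌈ 2 + m /2⌉ ≤ capacity (2 + m) e
⌈m/2⌉≤capacity zero          e e≥3 =
  ≤-trans (s≤s z≤n) (≤-trans (∸-monoˡ-≤ 1 (e≥3 (suc zero))) (m≤m+n _ 0))
⌈m/2⌉≤capacity (suc zero)    e e≥3 = ≤-trans (∸-monoˡ-≤ 1 (e≥3 (suc zero))) (m≤m+n _ 0)
⌈m/2⌉≤capacity (suc (suc m)) e e≥3 =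
  +-mono-≤ (≤-trans (s≤s z≤n) (∸-monoˡ-≤ 1 (e≥3 (suc zero))))
           (⌈m/2⌉≤capacity m (tail (tail e)) (λ i → e≥3 (suc (suc i))))

-- S is the number of edges that avoid the hub.
Realisation : (m : ℕ) → (Fin m → ℕ) → ℕ → Set
Realisation m e S = Σ (Multigraph (suc m)) λ G → Triangular G ×
  degree G zero + (S + S) ≡ Σℕ m e × (∀ j → degree G (suc j) ≡ e j)

realisation-pair : ∀ {m} (e : Fin (2 + m) → ℕ) → e (suc zero) ≤ e zero →
  ∀ y {S} → 1 ≤ y → y < e (suc zero) →
  Realisation m (tail (tail e)) S → Realisation (2 + m) e (y + S)
realisation-pair {m} e b≤a y {S} y≥1 y<b (M , M-triangular , M-hub , M-degree) =
  graph , triangular M-triangular (m<n⇒0<n∸m y<a) (m<n⇒0<n∸m y<b) y≥1 , hub , degrees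
  where
  a = e zero
  b = e (suc zero)
  open AttachPair M (a ∸ y) (b ∸ y) y
  y<a : y < a
  y<a = <-≤-trans y<b b≤a
  regroup : ∀ p q r y s → p + q + r + ((y + s) + (y + s)) ≡ (p + y) + ((q + y) + (r + (s + s)))
  regroup = solve-∀
  hub : degree graph zero + ((y + S) + (y + S)) ≡ Σℕ (2 + m) e
  hub = begin
    degree graph zero + ((y + S) + (y + S))
      ≡⟨ cong (λ t → t + ((y + S) + (y + S))) degree-hub ⟩
    (a ∸ y) + (b ∸ y) + degree M zero + ((y + S) + (y + S))
      ≡⟨ regroup (a ∸ y) (b ∸ y) (degree M zero) y S ⟩
    ((a ∸ y) + y) + (((b ∸ y) + y) + (degree M zero + (S + S)))
      ≡⟨ cong₂ _+_ (m∸n+n≡m (<⇒≤ y<a)) (cong₂ _+_ (m∸n+n≡m (<⇒≤ y<b)) M-hub) ⟩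
    a + (b + Σℕ m (tail (tail e))) ∎
    where open ≡-Reasoning
  degrees : ∀ j → degree graph (suc j) ≡ e j
  degrees zero          = trans degree-a (m∸n+n≡m (<⇒≤ y<a))
  degrees (suc zero)    = trans degree-b (m∸n+n≡m (<⇒≤ y<b))
  degrees (suc (suc j)) = M-degree j

realisation-block : (e : Fin 3 → ℕ) → e (suc zero) ≤ e zero → 1 < e (suc (suc zero)) →
  ∀ y → 1 ≤ y → suc y < e (suc zero) → Realisation 3 e (suc y)
realisation-block e b≤a c>1 y y≥1 1+y<b =
  graph , triangular (m<n⇒0<n∸m y<a) (m<n⇒0<n∸m 1+y<b) (m<n⇒0<n∸m c>1) y≥1 ≤-refl , hub , degrees
  where
  a = e zero
  b = e (suc zero)
  c = e (suc (suc zero))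
  open TwoTriangles (a ∸ y) (b ∸ suc y) (c ∸ 1) y 1
  y<a : y < a
  y<a = <-≤-trans (<-trans (n<1+n y) 1+y<b) b≤a
  regroup : ∀ p q r y → p + (q + (r + 0)) + (suc y + suc y) ≡ (p + y) + ((q + suc y) + ((r + 1) + 0))
  regroup = solve-∀
  hub : degree graph zero + (suc y + suc y) ≡ Σℕ 3 e
  hub = trans (regroup (a ∸ y) (b ∸ suc y) (c ∸ 1) y)
    (cong₂ _+_ (m∸n+n≡m (<⇒≤ y<a))
      (cong₂ _+_ (m∸n+n≡m (<⇒≤ 1+y<b)) (cong (_+ 0) (m∸n+n≡m (<⇒≤ c>1)))))
  degrees : ∀ j → degree graph (suc j) ≡ e j
  degrees zero             = trans (cong (λ t → (a ∸ y) + t) (+-identityʳ y)) (m∸n+n≡m (<⇒≤ y<a))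
  degrees (suc zero)       = trans (cong (λ t → (b ∸ suc y) + t) (+-comm y 1)) (m∸n+n≡m (<⇒≤ 1+y<b))
  degrees (suc (suc zero)) = m∸n+n≡m (<⇒≤ c>1)

Descending : (m : ℕ) → (Fin m → ℕ) → Set
Descending m e = ∀ i j → toℕ i ≤ toℕ j → e j ≤ e i

Descending-tail : ∀ {m} {e : Fin (suc m) → ℕ} → Descending (suc m) e → Descending m (tail e)
Descending-tail desc i j i≤j = desc (suc i) (suc j) (s≤s i≤j)

realise-pair : ∀ {m} (e : Fin (2 + m) → ℕ) → e (suc zero) ≤ e zero → 2 ≤ e (suc zero) →
  ⌈ m /2⌉ ≤ capacity m (tail (tail e)) →
  (∀ S → ⌈ m /2⌉ ≤ S → S ≤ capacity m (tail (tail e)) → Realisation m (tail (tail e)) S) →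
  ∀ S → ⌈ 2 + m /2⌉ ≤ S → S ≤ capacity (2 + m) e → Realisation (2 + m) e S
realise-pair e b≤a b≥2 nonempty realise-rest S lo hi
  with split-between (∸-monoˡ-≤ 1 b≥2) nonempty lo hi
... | y , y≥1 , y≤b∸1 , S′ , refl , lo′ , hi′ =
  realisation-pair e b≤a y y≥1 (m≤n∸1⇒m<n (≤-trans (s≤s z≤n) b≥2) y≤b∸1) (realise-rest S′ lo′ hi′)

realise : ∀ m (e : Fin m → ℕ) → Descending m e → (∀ i → 3 ≤ e i) →
  ∀ S → ⌈ m /2⌉ ≤ S → S ≤ capacity m e → Realisation m e S
realise zero e _ _ zero    _ _  = singleton , singleton-triangular , refl , λ ()
realise zero e _ _ (suc _) _ ()
realise (suc zero) e _ _ zero    () _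
realise (suc zero) e _ _ (suc _) _  ()
realise (suc (suc zero)) e desc e≥3 S lo hi =
  realise-pair e (desc zero (suc zero) z≤n) (≤-trans (n≤1+n 2) (e≥3 (suc zero))) z≤n
    (realise zero (tail (tail e)) (Descending-tail (Descending-tail desc)) (λ i → e≥3 (suc (suc i))))
    S lo hi
realise (suc (suc (suc zero))) e _ _ (suc zero) (s≤s ()) _
realise (suc (suc (suc zero))) e desc e≥3 (suc (suc y)) _ 2+y≤b∸1+0 =
  realisation-block e (desc zero (suc zero) z≤n) (≤-trans (s≤s (s≤s z≤n)) (e≥3 (suc (suc zero))))
    (suc y) (s≤s z≤n)
    (m≤n∸1⇒m<n (≤-trans (s≤s z≤n) (e≥3 (suc zero))) (subst (suc (suc y) ≤_) (+-identityʳ _) 2+y≤b∸1+0))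
realise (suc (suc m@(suc (suc _)))) e desc e≥3 S lo hi =
  realise-pair e (desc zero (suc zero) z≤n) (≤-trans (n≤1+n 2) (e≥3 (suc zero)))
    (⌈m/2⌉≤capacity _ (tail (tail e)) (λ i → e≥3 (suc (suc i))))
    (realise m (tail (tail e)) (Descending-tail (Descending-tail desc)) (λ i → e≥3 (suc (suc i))))
    S lo hi

⌈m/2⌉≤half-gap : ∀ {d₀ m} (e : Fin m → ℕ) {S} → (∀ i → 1 ≤ e i) →
  d₀ ≤ Σℕ m (λ i → e i ∸ 1) → d₀ + (S + S) ≡ Σℕ m e → ⌈ m /2⌉ ≤ S
⌈m/2⌉≤half-gap {d₀} {m} e {S} e≥1 d₀≤ gap = m≤n+n⇒⌈m/2⌉≤n (+-cancelˡ-≤ d₀ _ _ (begin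
  d₀ + m                       ≤⟨ +-monoˡ-≤ m d₀≤ ⟩
  Σℕ m (λ i → e i ∸ 1) + m     ≡⟨ Σℕ-∸1 m e e≥1 ⟩
  Σℕ m e                       ≡⟨ gap ⟨
  d₀ + (S + S)                 ∎))
  where open ≤-Reasoning

half-gap≤capacity : ∀ {d₀ k} (e : Fin (suc k) → ℕ) {S} → (∀ i → 1 ≤ e i) →
  k + evens (suc k) e ≤ d₀ + odds (suc k) e → d₀ + (S + S) ≡ Σℕ (suc k) e →
  S ≤ capacity (suc k) e
half-gap≤capacity {d₀} {k} e {S} e≥1 alt gap =
  m+m≤1+n+n⇒m≤n (+-cancelˡ-≤ (k + d₀) _ _ (begin
    k + d₀ + (S + S)          ≡⟨ +-assoc k d₀ _ ⟩
    k + (d₀ + (S + S))        ≡⟨ cong (λ t → k + t) (trans gap (Σℕ≡evens+odds (suc k) e)) ⟩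
    k + (E + O)               ≡⟨ +-assoc k E O ⟨
    k + E + O                 ≤⟨ +-monoˡ-≤ O alt ⟩
    d₀ + O + O                ≡⟨ cong (λ t → d₀ + t + t) (odds≡capacity+⌊m/2⌋ (suc k) e e≥1) ⟩
    d₀ + (C + F) + (C + F)    ≡⟨ regroup d₀ C F ⟩
    d₀ + (C + C) + (F + F)    ≤⟨ +-monoʳ-≤ (d₀ + (C + C)) (⌊m/2⌋+⌊m/2⌋≤m (suc k)) ⟩
    d₀ + (C + C) + suc k      ≡⟨ regroup′ d₀ C k ⟩
    k + d₀ + suc (C + C)      ∎))
  where
  open ≤-Reasoning
  E = evens (suc k) e
  O = odds (suc k) e
  C = capacity (suc k) e
  F = ⌊ suc k /2⌋
  regroup : ∀ d c f → d + (c + f) + (c + f) ≡ d + (c + c) + (f + f)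
  regroup = solve-∀
  regroup′ : ∀ d c k → d + (c + c) + suc k ≡ k + d + suc (c + c)
  regroup′ = solve-∀

realisation⇒degrees : ∀ {m} {d : Fin (suc m) → ℕ} {S} →
  d zero + (S + S) ≡ Σℕ m (tail d) → Realisation m (tail d) S →
  Σ (Multigraph (suc m)) λ G → Triangular G × (∀ i → degree G i ≡ d i)
realisation⇒degrees gap (G , G-triangular , G-hub , G-degree) = G , G-triangular , λ
  { zero    → +-cancelʳ-≡ _ _ _ (trans G-hub (sym gap))
  ; (suc j) → G-degree j
  }

lemma2p1 : (n : ℕ) → n ≥ 3 → (d : Fin n → ℕ) →
    (∀ (i j : Fin n) → 1 ≤ toℕ i → toℕ i ≤ toℕ j → d j ≤ d i) →
    (∀ (i : Fin n) → 1 ≤ toℕ i → 4 ≤ d i) →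
    2 ∣ Σℕ n d →
    ((i₀ : Fin n) → toℕ i₀ ≡ 0 → d i₀ ≤ ΣfromSecond n (λ i → d i ∸ 1)) →
    Σℤ n (λ i → altSign (toℕ i) (+ d i)) ℤ.≥ + (n ∸ 2) →
    Σ (Multigraph n) λ G → Triangular G × (∀ i → degree G i ≡ d i)
lemma2p1 (suc m@(suc (suc k))) (s≤s (s≤s (s≤s _))) d desc big even hub alt =
  realisation⇒degrees {S = S} S-gap (realise m e e-descending e≥3 S
    (⌈m/2⌉≤half-gap e e≥1 d₀≤Σe∸1 S-gap)
    (half-gap≤capacity {d zero} e e≥1 (alternatingΣ-bound (suc k) (suc m) d alt) S-gap))
  where
  e = tail d
  e-descending : Descending m e
  e-descending i j i≤j = desc (suc i) (suc j) (s≤s z≤n) (s≤s i≤j)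
  e≥3 : ∀ i → 3 ≤ e i
  e≥3 i = ≤-trans (n≤1+n 3) (big (suc i) (s≤s z≤n))
  e≥1 : ∀ i → 1 ≤ e i
  e≥1 i = ≤-trans (s≤s z≤n) (e≥3 i)
  d₀≤Σe∸1 : d zero ≤ Σℕ m (λ i → e i ∸ 1)
  d₀≤Σe∸1 = hub zero refl
  d₀≤Σe : d zero ≤ Σℕ m e
  d₀≤Σe = ≤-trans d₀≤Σe∸1 (subst (Σℕ m (λ i → e i ∸ 1) ≤_) (Σℕ-∸1 m e e≥1) (m≤m+n _ m))
  S : ℕ
  S = proj₁ (even-gap even d₀≤Σe)
  S-gap : d zero + (S + S) ≡ Σℕ m e
  S-gap = proj₂ (even-gap even d₀≤Σe)
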